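{- Let $m<-1$ be an integer and define integers $c_m(n)$ by $$\frac{1}{(1-x)^{m}}\prod_{i=0}^{\infty}\frac{1}{(1-x^{2^{i}})^{m}}=\sum_{n=0}^{\infty}c_{m}(n)x^{n}.$$ Then $c_m(n)\neq 0$ for every integer $n\ge 0$. -}

module Defs where

open import Data.Nat as ℕ using (ℕ; zero; suc; _∸_; _^_; _≟_)
open import Data.Nat.Combinatorics using (_C_)
open import Data.Integer as ℤ using (ℤ; +_; -[1+_]; _+_; _*_; -_)
open import Data.List using (List; upTo; map; foldr)
open import Relation.Nullary using (yes; no)

Series : Set
Series = ℕ → ℤ

sumTo : ℕ → (ℕ → ℤ) → ℤ
sumTo n f = foldr _+_ (+ 0) (map f (upTo (suc n)))

one : Series
one zero    = + 1
one (suc _) = + 0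

_⋆_ : Series → Series → Series
(f ⋆ g) n = sumTo n (λ i → f i * g (n ∸ i))

-- Substitution y ↦ x^d :  (f ∘ x^d)(x) = Σ_j f_j x^{d j}.
substPow : ℕ → Series → Series
substPow d f n = sumTo n (λ j → coef j)
  where
  coef : ℕ → ℤ
  coef j with j ℕ.* d ≟ n
  ... | yes _ = f j
  ... | no  _ = + 0

signPow : ℕ → ℤ
signPow zero    = + 1
signPow (suc j) = - signPow j

-- The power series of 1/(1-y)^m for an integer m (binomial series):
--   m ≥ 0 :  coefficient of y^j is  C(m+j-1, j)
--   m = -k:  1/(1-y)^m = (1-y)^k, coefficient of y^j is (-1)^j C(k, j)
invOneMinusPow : ℤ → Series
invOneMinusPow (+ m)     j = + ((m ℕ.+ j ∸ 1) C j)
invOneMinusPow -[1+ k ]  j = signPow j * (+ (suc k C j))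

factor : ℕ → ℤ → Series
factor d m = substPow d (invOneMinusPow m)

partialProd : ℤ → ℕ → Series
partialProd m zero    = one
partialProd m (suc N) = partialProd m N ⋆ factor (2 ^ N) m

-- Factors with 2^i > n are ≡ 1 mod x^{n+1}, so the coefficient of x^n of the
-- infinite product equals that of the partial product over i = 0..n
-- (2^i > n for all i > n).
c : ℤ → ℕ → ℤ
c m n = (invOneMinusPow m ⋆ partialProd m (suc n)) n

-- For m = -k with k ≥ 2 the generating function is ((1 - x) T)^k, where
-- T = ∏_{i≥0} (1 - x^(2^i)) has the Thue–Morse signs ±1 as coefficients
-- (T_{2t} = T_t, T_{2t+1} = -T_t).  Hence (1 - x) T = 1 + 2D with D_s ∈ {0, ±1},
-- and (1 + 2D)² = 1 + 4V with V = D + D², whose coefficients V_s (s ≥ 1) are odd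
-- by a parity computation with the Thue–Morse recursions.  Squaring gains one
-- power of 2: writing j = 2^e·(odd), (1 + 4V)^j = 1 + 2^(e+2)(V + 2E).  So for
-- n ≥ 1 the n-th coefficient of (1 + 2D)^(2j) is 2^(e+2)·(odd), and that of
-- (1 + 2D)^(2j+1) is 2D_n + 2^(e+2)·(odd), which is nonzero whether D_n is 0 or
-- ±1; the constant coefficients are odd.

module Submission where

open import Defs
open import Algebra.Bundles using (CommutativeRing)
import Algebra.Construct.Pointwise as Pointwise
import Algebra.Solver.Ring
open import Algebra.Solver.Ring.AlmostCommutativeRing using (fromCommutativeRing; _-Raw-AlmostCommutative⟶_)
open import Data.Integer as ℤ using (ℤ; +_; -[1+_]; _+_; _*_; -_; _-_; _<_)
import Data.Integer.Properties as ℤ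
open import Data.Integer.Solver using (module +-*-Solver)
open import Algebra.Properties.CommutativeSemigroup ℤ.+-commutativeSemigroup using (interchange)
open import Data.List using ([]; _∷_; foldr; map; applyUpTo)
open import Data.Maybe as Maybe using (Maybe)
open import Data.Nat as ℕ using (ℕ; zero; suc; _∸_; z≤n; s≤s)
import Data.Nat.Properties as ℕ
open import Data.Nat.Combinatorics using (_C_; nCk+nC[k+1]≡[n+1]C[k+1])
open import Data.Nat.Divisibility using (_∣_; _∣?_; divides; divides-refl; >⇒∤; ∣m+n∣m⇒∣n; ∣-refl)
open import Data.Nat.Induction using (<-rec)
open import Data.Nat.Solver using () renaming (module +-*-Solver to ℕ-Solver)
open import Data.Product using (_,_; ∃-syntax)
open import Data.Sum using (_⊎_; inj₁; inj₂)
open import Function using (_∘_)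
open import Level using (0ℓ)
open import Relation.Binary.PropositionalEquality
open import Relation.Nullary using (yes; no; ¬_; contradiction)
open import Relation.Nullary.Decidable using (dec⇒maybe)

sum≤ : ℕ → (ℕ → ℤ) → ℤ
sum≤ zero    f = f 0
sum≤ (suc n) f = f 0 + sum≤ n (λ i → f (suc i))

syntax sum≤ n (λ i → e) = ∑[ i ≤ n ] e

foldr-map-cong : ∀ xs {f g : ℕ → ℤ} → (∀ i → f i ≡ g i) →
                 foldr _+_ (+ 0) (map f xs) ≡ foldr _+_ (+ 0) (map g xs)
foldr-map-cong []       f≡g = refl
foldr-map-cong (i ∷ xs) f≡g = cong₂ _+_ (f≡g i) (foldr-map-cong xs f≡g)

sumTo≡sum≤ : ∀ n f → sumTo n f ≡ sum≤ n f
sumTo≡sum≤ n f = go n (λ i → i)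
  where
  go : ∀ n (g : ℕ → ℕ) → foldr _+_ (+ 0) (map f (applyUpTo g (suc n))) ≡ ∑[ i ≤ n ] f (g i)
  go zero    g = ℤ.+-identityʳ (f (g 0))
  go (suc n) g = cong (_+_ (f (g 0))) (go n (λ i → g (suc i)))

sum≤-cong : ∀ n {f g : ℕ → ℤ} → (∀ i → i ℕ.≤ n → f i ≡ g i) → sum≤ n f ≡ sum≤ n g
sum≤-cong zero    f≡g = f≡g 0 z≤n
sum≤-cong (suc n) f≡g = cong₂ _+_ (f≡g 0 z≤n) (sum≤-cong n (λ i i≤n → f≡g (suc i) (s≤s i≤n)))

sum≤-zero : ∀ n {f : ℕ → ℤ} → (∀ i → i ℕ.≤ n → f i ≡ + 0) → sum≤ n f ≡ + 0
sum≤-zero zero    f≡0 = f≡0 0 z≤n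
sum≤-zero (suc n) f≡0 = cong₂ _+_ (f≡0 0 z≤n) (sum≤-zero n (λ i i≤n → f≡0 (suc i) (s≤s i≤n)))

sum≤-single : ∀ n {a} f → a ℕ.≤ n → (∀ i → i ≢ a → f i ≡ + 0) → sum≤ n f ≡ f a
sum≤-single zero    {zero}  f _         _    = refl
sum≤-single (suc n) {zero}  f _         f≡0 =
  trans (cong (_+_ (f 0)) (sum≤-zero n (λ i _ → f≡0 (suc i) λ ()))) (ℤ.+-identityʳ (f 0))
sum≤-single (suc n) {suc a} f (s≤s a≤n) f≡0 =
  trans (cong₂ _+_ (f≡0 0 λ ()) (sum≤-single n (λ i → f (suc i)) a≤n (λ i i≢a → f≡0 (suc i) (i≢a ∘ ℕ.suc-injective))))
        (ℤ.+-identityˡ (f (suc a)))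

sum≤-suc : ∀ n f → sum≤ (suc n) f ≡ sum≤ n f + f (suc n)
sum≤-suc zero    f = refl
sum≤-suc (suc n) f = begin
  f 0 + sum≤ (suc n) (λ i → f (suc i))      ≡⟨ cong (_+_ (f 0)) (sum≤-suc n (λ i → f (suc i))) ⟩
  f 0 + (sum≤ n (λ i → f (suc i)) + f (suc (suc n))) ≡⟨ ℤ.+-assoc (f 0) _ _ ⟨
  sum≤ (suc n) f + f (suc (suc n))          ∎
  where open ≡-Reasoning

sum≤-+ : ∀ n f g → (∑[ i ≤ n ] (f i + g i)) ≡ sum≤ n f + sum≤ n g
sum≤-+ zero    f g = refl
sum≤-+ (suc n) f g = begin
  (f 0 + g 0) + sum≤ n (λ i → f (suc i) + g (suc i))               ≡⟨ cong (_+_ (f 0 + g 0)) (sum≤-+ n _ _) ⟩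
  (f 0 + g 0) + (sum≤ n (λ i → f (suc i)) + sum≤ n (λ i → g (suc i))) ≡⟨ interchange (f 0) (g 0) _ _ ⟩
  sum≤ (suc n) f + sum≤ (suc n) g                                   ∎
  where open ≡-Reasoning

sum≤-*ˡ : ∀ n a f → (∑[ i ≤ n ] (a * f i)) ≡ a * sum≤ n f
sum≤-*ˡ zero    a f = refl
sum≤-*ˡ (suc n) a f = begin
  a * f 0 + sum≤ n (λ i → a * f (suc i)) ≡⟨ cong (_+_ (a * f 0)) (sum≤-*ˡ n a _) ⟩
  a * f 0 + a * sum≤ n (λ i → f (suc i)) ≡⟨ ℤ.*-distribˡ-+ a (f 0) _ ⟨
  a * sum≤ (suc n) f                     ∎
  where open ≡-Reasoning

sum≤-*ʳ : ∀ n a f → (∑[ i ≤ n ] (f i * a)) ≡ sum≤ n f * a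
sum≤-*ʳ n a f = begin
  ∑[ i ≤ n ] (f i * a) ≡⟨ sum≤-cong n (λ i _ → ℤ.*-comm (f i) a) ⟩
  ∑[ i ≤ n ] (a * f i) ≡⟨ sum≤-*ˡ n a f ⟩
  a * sum≤ n f         ≡⟨ ℤ.*-comm a _ ⟩
  sum≤ n f * a         ∎
  where open ≡-Reasoning

sum≤-reverse : ∀ n f → sum≤ n f ≡ ∑[ i ≤ n ] f (n ∸ i)
sum≤-reverse zero    f = refl
sum≤-reverse (suc n) f = begin
  sum≤ (suc n) f                        ≡⟨ sum≤-suc n f ⟩
  sum≤ n f + f (suc n)                  ≡⟨ cong (_+ f (suc n)) (sum≤-reverse n f) ⟩
  sum≤ n (λ i → f (n ∸ i)) + f (suc n)  ≡⟨ ℤ.+-comm _ (f (suc n)) ⟩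
  ∑[ i ≤ suc n ] f (suc n ∸ i)          ∎
  where open ≡-Reasoning

sum≤-exchange : ∀ n (F : ℕ → ℕ → ℤ) →
                (∑[ i ≤ n ] ∑[ a ≤ i ] F a i) ≡ (∑[ a ≤ n ] ∑[ b ≤ n ∸ a ] F a (a ℕ.+ b))
sum≤-exchange zero    F = refl
sum≤-exchange (suc n) F = begin
  F 0 0 + sum≤ n (λ i → F 0 (suc i) + sum≤ i (λ a → F (suc a) (suc i)))
    ≡⟨ cong (_+_ (F 0 0)) (sum≤-+ n _ _) ⟩
  F 0 0 + (sum≤ n (λ i → F 0 (suc i)) + sum≤ n (λ i → sum≤ i (λ a → F (suc a) (suc i))))
    ≡⟨ cong (λ x → F 0 0 + (sum≤ n (λ i → F 0 (suc i)) + x)) (sum≤-exchange n (λ a i → F (suc a) (suc i))) ⟩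
  F 0 0 + (sum≤ n (λ i → F 0 (suc i)) + ∑[ a ≤ n ] ∑[ b ≤ n ∸ a ] F (suc a) (suc a ℕ.+ b))
    ≡⟨ ℤ.+-assoc (F 0 0) _ _ ⟨
  ∑[ a ≤ suc n ] ∑[ b ≤ suc n ∸ a ] F a (a ℕ.+ b) ∎
  where open ≡-Reasoning

-- The commutative ring of power series

infix 4 _≐_
_≐_ : Series → Series → Set
f ≐ g = ∀ n → f n ≡ g n

infixl 6 _⊕_
_⊕_ : Series → Series → Series
(f ⊕ g) n = f n + g n

⊖_ : Series → Series
(⊖ f) n = - f n

𝟘 : Series
𝟘 _ = + 0

const : ℤ → Series
const a zero    = a
const a (suc _) = + 0

𝟙 : Series
𝟙 = const (+ 1)

⋆-coeff : ∀ f g n → (f ⋆ g) n ≡ ∑[ i ≤ n ] (f i * g (n ∸ i))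
⋆-coeff f g n = sumTo≡sum≤ n _

const-⋆ : ∀ a f n → (const a ⋆ f) n ≡ a * f n
const-⋆ a f zero    = ℤ.+-identityʳ (a * f 0)
const-⋆ a f (suc n) = begin
  (const a ⋆ f) (suc n)                   ≡⟨ ⋆-coeff (const a) f (suc n) ⟩
  a * f (suc n) + sum≤ n (λ i → + 0 * f (n ∸ i))  ≡⟨ cong (_+_ (a * f (suc n))) (sum≤-zero n (λ _ _ → refl)) ⟩
  a * f (suc n) + + 0                     ≡⟨ ℤ.+-identityʳ _ ⟩
  a * f (suc n)                           ∎
  where open ≡-Reasoning

⋆-cong : ∀ {f f′ g g′} → f ≐ f′ → g ≐ g′ → f ⋆ g ≐ f′ ⋆ g′
⋆-cong {f} {f′} {g} {g′} f≐f′ g≐g′ n = begin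
  (f ⋆ g) n                        ≡⟨ ⋆-coeff f g n ⟩
  ∑[ i ≤ n ] (f i * g (n ∸ i))     ≡⟨ sum≤-cong n (λ i _ → cong₂ _*_ (f≐f′ i) (g≐g′ (n ∸ i))) ⟩
  ∑[ i ≤ n ] (f′ i * g′ (n ∸ i))   ≡⟨ ⋆-coeff f′ g′ n ⟨
  (f′ ⋆ g′) n                      ∎
  where open ≡-Reasoning

⋆-comm : ∀ f g → f ⋆ g ≐ g ⋆ f
⋆-comm f g n = begin
  (f ⋆ g) n                               ≡⟨ ⋆-coeff f g n ⟩
  ∑[ i ≤ n ] (f i * g (n ∸ i))            ≡⟨ sum≤-reverse n _ ⟩
  ∑[ i ≤ n ] (f (n ∸ i) * g (n ∸ (n ∸ i))) ≡⟨ sum≤-cong n (λ i i≤n → trans (cong (λ j → f (n ∸ i) * g j) (ℕ.m∸[m∸n]≡n i≤n)) (ℤ.*-comm (f (n ∸ i)) (g i))) ⟩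
  ∑[ i ≤ n ] (g i * f (n ∸ i))            ≡⟨ ⋆-coeff g f n ⟨
  (g ⋆ f) n                               ∎
  where open ≡-Reasoning

⋆-assoc : ∀ f g h → (f ⋆ g) ⋆ h ≐ f ⋆ (g ⋆ h)
⋆-assoc f g h n = begin
  ((f ⋆ g) ⋆ h) n
    ≡⟨ ⋆-coeff (f ⋆ g) h n ⟩
  ∑[ i ≤ n ] ((f ⋆ g) i * h (n ∸ i))
    ≡⟨ sum≤-cong n (λ i _ → trans (cong (_* h (n ∸ i)) (⋆-coeff f g i)) (sym (sum≤-*ʳ i _ _))) ⟩
  ∑[ i ≤ n ] ∑[ a ≤ i ] (f a * g (i ∸ a) * h (n ∸ i))
    ≡⟨ sum≤-exchange n (λ a i → f a * g (i ∸ a) * h (n ∸ i)) ⟩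
  ∑[ a ≤ n ] ∑[ b ≤ n ∸ a ] (f a * g (a ℕ.+ b ∸ a) * h (n ∸ (a ℕ.+ b)))
    ≡⟨ sum≤-cong n (λ a _ → sum≤-cong (n ∸ a) (λ b _ → regroup a b)) ⟩
  ∑[ a ≤ n ] ∑[ b ≤ n ∸ a ] (f a * (g b * h (n ∸ a ∸ b)))
    ≡⟨ sum≤-cong n (λ a _ → trans (sum≤-*ˡ (n ∸ a) (f a) _) (cong (_*_ (f a)) (sym (⋆-coeff g h (n ∸ a))))) ⟩
  ∑[ a ≤ n ] (f a * (g ⋆ h) (n ∸ a))
    ≡⟨ ⋆-coeff f (g ⋆ h) n ⟨
  (f ⋆ (g ⋆ h)) n ∎
  where
  open ≡-Reasoning
  regroup : ∀ a b → f a * g (a ℕ.+ b ∸ a) * h (n ∸ (a ℕ.+ b)) ≡ f a * (g b * h (n ∸ a ∸ b))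
  regroup a b = trans (cong₂ (λ u v → f a * g u * h v) (ℕ.m+n∸m≡n a b) (sym (ℕ.∸-+-assoc n a b)))
                      (ℤ.*-assoc (f a) (g b) _)

⋆-distribʳ-⊕ : ∀ h f g → (f ⊕ g) ⋆ h ≐ f ⋆ h ⊕ g ⋆ h
⋆-distribʳ-⊕ h f g n = begin
  ((f ⊕ g) ⋆ h) n                                        ≡⟨ ⋆-coeff (f ⊕ g) h n ⟩
  ∑[ i ≤ n ] ((f i + g i) * h (n ∸ i))                   ≡⟨ sum≤-cong n (λ i _ → ℤ.*-distribʳ-+ (h (n ∸ i)) (f i) (g i)) ⟩
  ∑[ i ≤ n ] (f i * h (n ∸ i) + g i * h (n ∸ i))         ≡⟨ sum≤-+ n _ _ ⟩
  ∑[ i ≤ n ] (f i * h (n ∸ i)) + ∑[ i ≤ n ] (g i * h (n ∸ i)) ≡⟨ cong₂ _+_ (⋆-coeff f h n) (⋆-coeff g h n) ⟨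
  (f ⋆ h ⊕ g ⋆ h) n                                      ∎
  where open ≡-Reasoning

⋆-distribˡ-⊕ : ∀ h f g → h ⋆ (f ⊕ g) ≐ h ⋆ f ⊕ h ⋆ g
⋆-distribˡ-⊕ h f g n = begin
  (h ⋆ (f ⊕ g)) n           ≡⟨ ⋆-comm h (f ⊕ g) n ⟩
  ((f ⊕ g) ⋆ h) n           ≡⟨ ⋆-distribʳ-⊕ h f g n ⟩
  (f ⋆ h) n + (g ⋆ h) n     ≡⟨ cong₂ _+_ (⋆-comm f h n) (⋆-comm g h n) ⟩
  (h ⋆ f ⊕ h ⋆ g) n         ∎
  where open ≡-Reasoning

⋆-identityˡ : ∀ f → 𝟙 ⋆ f ≐ f
⋆-identityˡ f n = trans (const-⋆ (+ 1) f n) (ℤ.*-identityˡ (f n))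

series : CommutativeRing 0ℓ 0ℓ
series = record
  { Carrier = Series
  ; _≈_ = _≐_
  ; _+_ = _⊕_
  ; _*_ = _⋆_
  ; -_ = ⊖_
  ; 0# = 𝟘
  ; 1# = 𝟙
  ; isCommutativeRing = record
    { isRing = record
      { +-isAbelianGroup = Pointwise.isAbelianGroup ℕ ℤ.+-0-isAbelianGroup
      ; *-cong = ⋆-cong
      ; *-assoc = ⋆-assoc
      ; *-identity = ⋆-identityˡ , λ f n → trans (⋆-comm f 𝟙 n) (⋆-identityˡ f n)
      ; distrib = ⋆-distribˡ-⊕ , ⋆-distribʳ-⊕
      }
    ; *-comm = ⋆-comm
    }
  }

const-* : ∀ a b → const (a * b) ≐ const a ⋆ const b
const-* a b n = sym (trans (const-⋆ a (const b) n) (lemma n))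
  where
  lemma : ∀ n → a * const b n ≡ const (a * b) n
  lemma zero    = refl
  lemma (suc _) = ℤ.*-zeroʳ a

const-homomorphism : ℤ.+-*-rawRing -Raw-AlmostCommutative⟶ fromCommutativeRing series
const-homomorphism = record
  { ⟦_⟧    = const
  ; +-homo = λ a b → λ { zero → refl ; (suc _) → refl }
  ; *-homo = const-*
  ; -‿homo = λ a → λ { zero → refl ; (suc _) → refl }
  ; 0-homo = λ { zero → refl ; (suc _) → refl }
  ; 1-homo = λ _ → refl
  }

const-≟ : ∀ a b → Maybe (const a ≐ const b)
const-≟ a b = Maybe.map (λ { refl _ → refl }) (dec⇒maybe (a ℤ.≟ b))

module ⋆-Solver = Algebra.Solver.Ring ℤ.+-*-rawRing (fromCommutativeRing series) const-homomorphism const-≟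
open import Algebra.Properties.CommutativeSemiring.Exp (CommutativeRing.commutativeSemiring series)
  using (_^_; ^-congˡ; ^-congʳ; ^-homo-*; ^-assocʳ; ^-distrib-*)
open import Algebra.Properties.Ring (CommutativeRing.ring series) using (-‿distribˡ-*)

⊖-⋆ : ∀ f g n → ((⊖ f) ⋆ g) n ≡ - (f ⋆ g) n
⊖-⋆ f g n = sym (-‿distribˡ-* f g n)

one≐𝟙 : one ≐ 𝟙
one≐𝟙 zero    = refl
one≐𝟙 (suc _) = refl

𝟙-^ : ∀ k → 𝟙 ^ k ≐ 𝟙
𝟙-^ zero    _ = refl
𝟙-^ (suc k) s = trans (⋆-identityˡ (𝟙 ^ k) s) (𝟙-^ k s)

x : Series
x zero    = + 0
x (suc i) = 𝟙 i

x-⋆-suc : ∀ f s → (x ⋆ f) (suc s) ≡ f s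
x-⋆-suc f s = begin
  (x ⋆ f) (suc s)                              ≡⟨ ⋆-coeff x f (suc s) ⟩
  + 0 * f (suc s) + ∑[ i ≤ s ] (𝟙 i * f (s ∸ i)) ≡⟨ cong (_+_ (+ 0 * f (suc s))) (⋆-coeff 𝟙 f s) ⟨
  + 0 * f (suc s) + (𝟙 ⋆ f) s                  ≡⟨ ℤ.+-identityˡ _ ⟩
  (𝟙 ⋆ f) s                                    ≡⟨ ⋆-identityˡ f s ⟩
  f s                                          ∎
  where open ≡-Reasoning

x^-⋆-+ : ∀ d r f → ((x ^ d) ⋆ f) (d ℕ.+ r) ≡ f r
x^-⋆-+ zero    r f = ⋆-identityˡ f r
x^-⋆-+ (suc d) r f = begin
  ((x ⋆ (x ^ d)) ⋆ f) (suc d ℕ.+ r)  ≡⟨ ⋆-assoc x (x ^ d) f (suc (d ℕ.+ r)) ⟩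
  (x ⋆ ((x ^ d) ⋆ f)) (suc d ℕ.+ r)  ≡⟨ x-⋆-suc ((x ^ d) ⋆ f) (d ℕ.+ r) ⟩
  ((x ^ d) ⋆ f) (d ℕ.+ r)            ≡⟨ x^-⋆-+ d r f ⟩
  f r                                ∎
  where open ≡-Reasoning

x^-⋆-< : ∀ d f {s} → s ℕ.< d → ((x ^ d) ⋆ f) s ≡ + 0
x^-⋆-< (suc d) f {zero}  _         = ⋆-assoc x (x ^ d) f 0
x^-⋆-< (suc d) f {suc s} (s≤s s<d) = begin
  ((x ⋆ (x ^ d)) ⋆ f) (suc s)  ≡⟨ ⋆-assoc x (x ^ d) f (suc s) ⟩
  (x ⋆ ((x ^ d) ⋆ f)) (suc s)  ≡⟨ x-⋆-suc ((x ^ d) ⋆ f) s ⟩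
  ((x ^ d) ⋆ f) s              ≡⟨ x^-⋆-< d f s<d ⟩
  + 0                          ∎
  where open ≡-Reasoning

infix 8 1-x^_
1-x^_ : ℕ → Series
1-x^ d = 𝟙 ⊕ ⊖ (x ^ d)

1-x^-⋆ : ∀ d f s → ((1-x^ d) ⋆ f) s ≡ f s - ((x ^ d) ⋆ f) s
1-x^-⋆ d f s = trans (⋆-distribʳ-⊕ f 𝟙 (⊖ (x ^ d)) s) (cong₂ _+_ (⋆-identityˡ f s) (⊖-⋆ (x ^ d) f s))

1-x^-⋆-< : ∀ d f {s} → s ℕ.< d → ((1-x^ d) ⋆ f) s ≡ f s
1-x^-⋆-< d f {s} s<d = begin
  ((1-x^ d) ⋆ f) s          ≡⟨ 1-x^-⋆ d f s ⟩
  f s - ((x ^ d) ⋆ f) s     ≡⟨ cong (_-_ (f s)) (x^-⋆-< d f s<d) ⟩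
  f s - + 0                 ≡⟨ ℤ.+-identityʳ (f s) ⟩
  f s                       ∎
  where open ≡-Reasoning

1-x^-⋆-+ : ∀ d r f → ((1-x^ d) ⋆ f) (d ℕ.+ r) ≡ f (d ℕ.+ r) - f r
1-x^-⋆-+ d r f = trans (1-x^-⋆ d f (d ℕ.+ r)) (cong (_-_ (f (d ℕ.+ r))) (x^-⋆-+ d r f))

data Split (a : ℕ) : ℕ → Set where
  below : ∀ {s} → s ℕ.< a → Split a s
  above : ∀ r → Split a (a ℕ.+ r)

split : ∀ a s → Split a s
split a s with ℕ.<-≤-connex s a
... | inj₁ s<a = below s<a
... | inj₂ a≤s with ℕ.m≤n⇒∃[o]m+o≡n a≤s
...   | r , refl = above r

-- The binomial series and the substitution x ↦ x^d

1-x-^-coeff : ∀ k j → ((1-x^ 1) ^ k) j ≡ signPow j * + (k C j)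
1-x-^-coeff zero    zero    = refl
1-x-^-coeff zero    (suc j) = sym (ℤ.*-zeroʳ (signPow (suc j)))
1-x-^-coeff (suc k) zero    = trans (1-x^-⋆-< 1 ((1-x^ 1) ^ k) (s≤s z≤n)) (1-x-^-coeff k 0)
1-x-^-coeff (suc k) (suc j) = begin
  ((1-x^ 1) ⋆ ((1-x^ 1) ^ k)) (suc j)                      ≡⟨ 1-x^-⋆-+ 1 j ((1-x^ 1) ^ k) ⟩
  ((1-x^ 1) ^ k) (suc j) - ((1-x^ 1) ^ k) j                ≡⟨ cong₂ _-_ (1-x-^-coeff k (suc j)) (1-x-^-coeff k j) ⟩
  - σ * + (k C suc j) - σ * + (k C j)                      ≡⟨ solve 3 (λ s a b → (:- s) :* b :- s :* a := (:- s) :* (a :+ b)) refl σ (+ (k C j)) (+ (k C suc j)) ⟩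
  - σ * (+ (k C j) + + (k C suc j))                        ≡⟨ cong (λ n → - σ * n) (ℤ.pos-+ (k C j) (k C suc j)) ⟨
  - σ * + (k C j ℕ.+ k C suc j)                            ≡⟨ cong (λ n → - σ * + n) (nCk+nC[k+1]≡[n+1]C[k+1] k j) ⟩
  - σ * + (suc k C suc j)                                  ∎
  where
  open ≡-Reasoning
  open +-*-Solver
  σ = signPow j

-- The coefficient function local to Defs.substPow cannot be named; this is a copy of it.
substPowTerm : ℕ → Series → ℕ → ℕ → ℤ
substPowTerm d f n j with j ℕ.* d ℕ.≟ n
... | yes _ = f j
... | no  _ = + 0

substPowTerm-agrees : ∀ d f n j → _ ≡ substPowTerm d f n j

substPow≡sum≤ : ∀ d f n → substPow d f n ≡ ∑[ j ≤ n ] substPowTerm d f n j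
substPow≡sum≤ d f n = trans (go d f n) (sumTo≡sum≤ n (substPowTerm d f n))
  where
  go : ∀ d f n → substPow d f n ≡ sumTo n (substPowTerm d f n)
  go d f n with 0 ℕ.≟ n
  ... | yes _ = cong (λ y → f 0 + y) (foldr-map-cong (applyUpTo suc n) (substPowTerm-agrees d f n))
  ... | no  _ = cong (λ y → + 0 + y) (foldr-map-cong (applyUpTo suc n) (substPowTerm-agrees d f n))

substPowTerm-agrees d f n j with j ℕ.* d ℕ.≟ n
... | yes _ = refl
... | no  _ = refl

substPow-multiple : ∀ d .{{_ : ℕ.NonZero d}} f q → substPow d f (q ℕ.* d) ≡ f q
substPow-multiple d f q = begin
  substPow d f (q ℕ.* d)                          ≡⟨ substPow≡sum≤ d f (q ℕ.* d) ⟩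
  ∑[ j ≤ q ℕ.* d ] substPowTerm d f (q ℕ.* d) j   ≡⟨ sum≤-single (q ℕ.* d) _ (ℕ.m≤m*n q d) others ⟩
  substPowTerm d f (q ℕ.* d) q                    ≡⟨ term-q ⟩
  f q                                             ∎
  where
  open ≡-Reasoning
  term-q : substPowTerm d f (q ℕ.* d) q ≡ f q
  term-q with q ℕ.* d ℕ.≟ q ℕ.* d
  ... | yes _   = refl
  ... | no  q≢q = contradiction refl q≢q
  others : ∀ j → j ≢ q → substPowTerm d f (q ℕ.* d) j ≡ + 0
  others j j≢q with j ℕ.* d ℕ.≟ q ℕ.* d
  ... | yes jd≡qd = contradiction (ℕ.*-cancelʳ-≡ j q d jd≡qd) j≢q
  ... | no  _     = refl

substPow-nonmultiple : ∀ d f {n} → ¬ d ∣ n → substPow d f n ≡ + 0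
substPow-nonmultiple d f {n} d∤n = trans (substPow≡sum≤ d f n) (sum≤-zero n (λ j _ → term-j j))
  where
  term-j : ∀ j → substPowTerm d f n j ≡ + 0
  term-j j with j ℕ.* d ℕ.≟ n
  ... | yes jd≡n = contradiction (divides j (sym jd≡n)) d∤n
  ... | no  _    = refl

substPow-cong : ∀ d .{{_ : ℕ.NonZero d}} {f g} → f ≐ g → substPow d f ≐ substPow d g
substPow-cong d {f} {g} f≐g n with d ∣? n
... | yes (divides-refl q) = trans (substPow-multiple d f q) (trans (f≐g q) (sym (substPow-multiple d g q)))
... | no  d∤n              = trans (substPow-nonmultiple d f d∤n) (sym (substPow-nonmultiple d g d∤n))

substPow-𝟙 : ∀ d .{{_ : ℕ.NonZero d}} → substPow d 𝟙 ≐ 𝟙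
substPow-𝟙 d@(suc _) n with d ∣? n
... | yes (divides-refl q) = trans (substPow-multiple d 𝟙 q) (lemma q)
  where
  lemma : ∀ q → 𝟙 q ≡ 𝟙 (q ℕ.* d)
  lemma zero    = refl
  lemma (suc _) = refl
... | no  d∤n = trans (substPow-nonmultiple d 𝟙 d∤n) (lemma n d∤n)
  where
  lemma : ∀ n → ¬ d ∣ n → + 0 ≡ 𝟙 n
  lemma zero    d∤0 = contradiction (divides-refl 0) d∤0
  lemma (suc _) _   = refl

substPow-1-x-⋆ : ∀ d .{{_ : ℕ.NonZero d}} g → substPow d ((1-x^ 1) ⋆ g) ≐ (1-x^ d) ⋆ substPow d g
substPow-1-x-⋆ d g s with split d s
... | below s<d = trans (below-d s s<d) (sym (1-x^-⋆-< d (substPow d g) s<d))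
  where
  below-d : ∀ s → s ℕ.< d → substPow d ((1-x^ 1) ⋆ g) s ≡ substPow d g s
  below-d zero    _   = trans (substPow-multiple d ((1-x^ 1) ⋆ g) 0)
                              (trans (1-x^-⋆-< 1 g (s≤s z≤n)) (sym (substPow-multiple d g 0)))
  below-d (suc s) s<d = trans (substPow-nonmultiple d ((1-x^ 1) ⋆ g) d∤s) (sym (substPow-nonmultiple d g d∤s))
    where d∤s = >⇒∤ s<d
... | above r with d ∣? r
...   | yes (divides-refl q) = begin
  substPow d ((1-x^ 1) ⋆ g) (suc q ℕ.* d)                  ≡⟨ substPow-multiple d ((1-x^ 1) ⋆ g) (suc q) ⟩
  ((1-x^ 1) ⋆ g) (suc q)                                   ≡⟨ 1-x^-⋆-+ 1 q g ⟩
  g (suc q) - g q                                          ≡⟨ cong₂ _-_ (substPow-multiple d g (suc q)) (substPow-multiple d g q) ⟨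
  substPow d g (d ℕ.+ q ℕ.* d) - substPow d g (q ℕ.* d)    ≡⟨ 1-x^-⋆-+ d (q ℕ.* d) (substPow d g) ⟨
  ((1-x^ d) ⋆ substPow d g) (d ℕ.+ q ℕ.* d)                ∎
  where open ≡-Reasoning
...   | no  d∤r = begin
  substPow d ((1-x^ 1) ⋆ g) (d ℕ.+ r)       ≡⟨ substPow-nonmultiple d ((1-x^ 1) ⋆ g) d∤d+r ⟩
  + 0                                       ≡⟨ cong₂ _-_ (substPow-nonmultiple d g d∤d+r) (substPow-nonmultiple d g d∤r) ⟨
  substPow d g (d ℕ.+ r) - substPow d g r   ≡⟨ 1-x^-⋆-+ d r (substPow d g) ⟨
  ((1-x^ d) ⋆ substPow d g) (d ℕ.+ r)       ∎
  where
  open ≡-Reasoning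
  d∤d+r : ¬ d ∣ d ℕ.+ r
  d∤d+r d∣d+r = d∤r (∣m+n∣m⇒∣n d∣d+r ∣-refl)

substPow-1-x-^ : ∀ d .{{_ : ℕ.NonZero d}} k → substPow d ((1-x^ 1) ^ k) ≐ (1-x^ d) ^ k
substPow-1-x-^ d zero    = substPow-𝟙 d
substPow-1-x-^ d (suc k) s =
  trans (substPow-1-x-⋆ d ((1-x^ 1) ^ k) s) (⋆-cong {1-x^ d} (λ _ → refl) (substPow-1-x-^ d k) s)

factor-neg : ∀ d .{{_ : ℕ.NonZero d}} k → factor d -[1+ k ] ≐ (1-x^ d) ^ suc k
factor-neg d k s = trans (substPow-cong d (λ j → sym (1-x-^-coeff (suc k) j)) s) (substPow-1-x-^ d (suc k) s)

data Parity : ℕ → Set where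
  even : ∀ t → Parity (2 ℕ.* t)
  odd  : ∀ t → Parity (suc (2 ℕ.* t))

parity : ∀ s → Parity s
parity zero = even 0
parity (suc s) with parity s
... | even t = odd t
... | odd  t = subst Parity (ℕ.*-suc 2 t) (even (suc t))

bit+double-< : ∀ {b t a} → b ℕ.< 2 → t ℕ.< a → b ℕ.+ 2 ℕ.* t ℕ.< 2 ℕ.* a
bit+double-< {b} {t} {a} b<2 t<a = begin-strict
  b ℕ.+ 2 ℕ.* t  <⟨ ℕ.+-monoˡ-< (2 ℕ.* t) b<2 ⟩
  2 ℕ.+ 2 ℕ.* t  ≡⟨ ℕ.*-suc 2 t ⟨
  2 ℕ.* suc t    ≤⟨ ℕ.*-monoʳ-≤ 2 t<a ⟩
  2 ℕ.* a        ∎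
  where open ℕ.≤-Reasoning

bit+double-<⁻¹ : ∀ {b t a} → b ℕ.+ 2 ℕ.* t ℕ.< 2 ℕ.* a → t ℕ.< a
bit+double-<⁻¹ {b} {t} {a} lt = ℕ.*-cancelˡ-< 2 t a (ℕ.≤-<-trans (ℕ.m≤n+m (2 ℕ.* t) b) lt)

bit+double-+ : ∀ b a r → b ℕ.+ 2 ℕ.* (a ℕ.+ r) ≡ 2 ℕ.* a ℕ.+ (b ℕ.+ 2 ℕ.* r)
bit+double-+ = solve 3 (λ b a r → b :+ con 2 :* (a :+ r) := con 2 :* a :+ (b :+ con 2 :* r)) refl
  where open ℕ-Solver

n<2^n : ∀ n → n ℕ.< 2 ℕ.^ n
n<2^n zero    = s≤s z≤n
n<2^n (suc n) = ℕ.≤-<-trans (s≤s (ℕ.m≤n*m n 2)) (bit+double-< (s≤s (s≤s z≤n)) (n<2^n n))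

n<2^[1+n] : ∀ n → n ℕ.< 2 ℕ.^ suc n
n<2^[1+n] n = ℕ.<-trans (ℕ.n<1+n n) (n<2^n (suc n))

IsUnit : ℤ → Set
IsUnit z = z ≡ + 1 ⊎ z ≡ - + 1

IsUnit-neg : ∀ {z} → IsUnit z → IsUnit (- z)
IsUnit-neg (inj₁ refl) = inj₂ refl
IsUnit-neg (inj₂ refl) = inj₁ refl

Odd : ℤ → Set
Odd a = ∃[ k ] a ≡ + 1 + + 2 * k

IsUnit⇒Odd : ∀ {a} → IsUnit a → Odd a
IsUnit⇒Odd (inj₁ refl) = + 0 , refl
IsUnit⇒Odd (inj₂ refl) = - + 1 , refl

Odd-+-even : ∀ {a} k → Odd a → Odd (a + + 2 * k)
Odd-+-even k (j , refl) = j + k , solve 2 (λ j k → con (+ 1) :+ con (+ 2) :* j :+ con (+ 2) :* k := con (+ 1) :+ con (+ 2) :* (j :+ k)) refl j k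
  where open +-*-Solver

Odd⇒≢0 : ∀ {a} → Odd a → a ≢ + 0
Odd⇒≢0 (k , refl) 1+2k≡0 = ℕ.even≢odd ℤ.∣ - k ∣ 0 (sym (trans (cong ℤ.∣_∣ 1≡2[-k]) (ℤ.abs-* (+ 2) (- k))))
  where
  1≡2[-k] : + 1 ≡ + 2 * - k
  1≡2[-k] = begin
    + 1                          ≡⟨ solve 1 (λ k → con (+ 1) := con (+ 1) :+ con (+ 2) :* k :+ con (+ 2) :* (:- k)) refl k ⟩
    + 1 + + 2 * k + + 2 * - k    ≡⟨ cong (_+ + 2 * - k) 1+2k≡0 ⟩
    + 0 + + 2 * - k              ≡⟨ ℤ.+-identityˡ _ ⟩
    + 2 * - k                    ∎
    where
    open ≡-Reasoning
    open +-*-Solver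

*-≢0 : ∀ {a b} → a ≢ + 0 → b ≢ + 0 → a * b ≢ + 0
*-≢0 {a} a≢0 b≢0 ab≡0 with ℤ.i*j≡0⇒i≡0∨j≡0 a ab≡0
... | inj₁ a≡0 = a≢0 a≡0
... | inj₂ b≡0 = b≢0 b≡0

2^≢0 : ∀ e → (+ 2) ℤ.^ e ≢ + 0
2^≢0 e 2^e≡0 with () ← ℤ.i^n≡0⇒i≡0 (+ 2) e 2^e≡0

jump : ℤ → ℤ → ℤ
jump a b with a ℤ.≟ b
... | yes _ = + 0
... | no  _ = b

jump-units : ∀ {a b} → IsUnit a → IsUnit b → b - a ≡ + 2 * jump a b
jump-units (inj₁ refl) (inj₁ refl) = refl
jump-units (inj₁ refl) (inj₂ refl) = refl
jump-units (inj₂ refl) (inj₁ refl) = refl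
jump-units (inj₂ refl) (inj₂ refl) = refl

jump-units-cases : ∀ {a b} → IsUnit a → IsUnit b → jump a b ≡ + 0 ⊎ IsUnit (jump a b)
jump-units-cases (inj₁ refl) (inj₁ refl) = inj₁ refl
jump-units-cases (inj₁ refl) (inj₂ refl) = inj₂ (inj₂ refl)
jump-units-cases (inj₂ refl) (inj₁ refl) = inj₂ (inj₁ refl)
jump-units-cases (inj₂ refl) (inj₂ refl) = inj₁ refl

jump-neg-Odd : ∀ {a} → IsUnit a → Odd (jump a (- a))
jump-neg-Odd (inj₁ refl) = - + 1 , refl
jump-neg-Odd (inj₂ refl) = + 0 , refl

jump-neg+jump²-Odd : ∀ {a b} → IsUnit a → IsUnit b → Odd (jump (- a) b + jump a b * jump a b)
jump-neg+jump²-Odd (inj₁ refl) (inj₁ refl) = + 0 , refl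
jump-neg+jump²-Odd (inj₁ refl) (inj₂ refl) = + 0 , refl
jump-neg+jump²-Odd (inj₂ refl) (inj₁ refl) = + 0 , refl
jump-neg+jump²-Odd (inj₂ refl) (inj₂ refl) = - + 1 , refl

-- Squares of series modulo 2

⋆-self-suc-suc : ∀ f s → (f ⋆ f) (suc (suc s)) ≡ + 2 * (f 0 * f (suc (suc s))) + ((f ∘ suc) ⋆ (f ∘ suc)) s
⋆-self-suc-suc f s = begin
  (f ⋆ f) (suc (suc s))
    ≡⟨ ⋆-coeff f f (suc (suc s)) ⟩
  f 0 * f (suc (suc s)) + ∑[ i ≤ suc s ] (f (suc i) * f (suc s ∸ i))
    ≡⟨ cong (_+_ (f 0 * f (suc (suc s)))) (sum≤-suc s _) ⟩
  f 0 * f (suc (suc s)) + (∑[ i ≤ s ] (f (suc i) * f (suc s ∸ i)) + f (suc (suc s)) * f (s ∸ s))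
    ≡⟨ cong₂ (λ u v → f 0 * f (suc (suc s)) + (u + f (suc (suc s)) * f v)) middle (ℕ.n∸n≡0 s) ⟩
  f 0 * f (suc (suc s)) + (((f ∘ suc) ⋆ (f ∘ suc)) s + f (suc (suc s)) * f 0)
    ≡⟨ solve 3 (λ a b c → a :* b :+ (c :+ b :* a) := con (+ 2) :* (a :* b) :+ c) refl (f 0) (f (suc (suc s))) (((f ∘ suc) ⋆ (f ∘ suc)) s) ⟩
  + 2 * (f 0 * f (suc (suc s))) + ((f ∘ suc) ⋆ (f ∘ suc)) s
    ∎
  where
  open ≡-Reasoning
  open +-*-Solver
  middle : ∑[ i ≤ s ] (f (suc i) * f (suc s ∸ i)) ≡ ((f ∘ suc) ⋆ (f ∘ suc)) s
  middle = trans (sum≤-cong s (λ i i≤s → cong (λ j → f (suc i) * f j) (ℕ.+-∸-assoc 1 i≤s)))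
                 (sym (⋆-coeff (f ∘ suc) (f ∘ suc) s))

⋆-self-even : ∀ f t → ∃[ k ] (f ⋆ f) (2 ℕ.* t) ≡ f t * f t + + 2 * k
⋆-self-even f zero    = + 0 , refl
⋆-self-even f (suc t) with ⋆-self-even (f ∘ suc) t
... | k , eq = f 0 * f (2 ℕ.* suc t) + k , (begin
  (f ⋆ f) (2 ℕ.* suc t)
    ≡⟨ cong (f ⋆ f) (ℕ.*-suc 2 t) ⟩
  (f ⋆ f) (suc (suc (2 ℕ.* t)))
    ≡⟨ ⋆-self-suc-suc f (2 ℕ.* t) ⟩
  + 2 * (f 0 * f (suc (suc (2 ℕ.* t)))) + ((f ∘ suc) ⋆ (f ∘ suc)) (2 ℕ.* t)
    ≡⟨ cong₂ (λ s u → + 2 * (f 0 * f s) + u) (ℕ.*-suc 2 t) (sym eq) ⟨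
  + 2 * (f 0 * f (2 ℕ.* suc t)) + (f (suc t) * f (suc t) + + 2 * k)
    ≡⟨ solve 3 (λ a b k → con (+ 2) :* a :+ (b :+ con (+ 2) :* k) := b :+ con (+ 2) :* (a :+ k)) refl (f 0 * f (2 ℕ.* suc t)) (f (suc t) * f (suc t)) k ⟩
  f (suc t) * f (suc t) + + 2 * (f 0 * f (2 ℕ.* suc t) + k)
    ∎)
  where
  open ≡-Reasoning
  open +-*-Solver

⋆-self-odd : ∀ f t → ∃[ k ] (f ⋆ f) (suc (2 ℕ.* t)) ≡ + 2 * k
⋆-self-odd f zero    = f 0 * f 1 , (begin
  f 0 * f 1 + (f 1 * f 0 + + 0)  ≡⟨ solve 2 (λ a b → a :* b :+ (b :* a :+ con (+ 0)) := con (+ 2) :* (a :* b)) refl (f 0) (f 1) ⟩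
  + 2 * (f 0 * f 1)              ∎)
  where
  open ≡-Reasoning
  open +-*-Solver
⋆-self-odd f (suc t) with ⋆-self-odd (f ∘ suc) t
... | k , eq = f 0 * f (suc (2 ℕ.* suc t)) + k , (begin
  (f ⋆ f) (suc (2 ℕ.* suc t))
    ≡⟨ cong (λ s → (f ⋆ f) (suc s)) (ℕ.*-suc 2 t) ⟩
  (f ⋆ f) (suc (suc (suc (2 ℕ.* t))))
    ≡⟨ ⋆-self-suc-suc f (suc (2 ℕ.* t)) ⟩
  + 2 * (f 0 * f (suc (suc (suc (2 ℕ.* t))))) + ((f ∘ suc) ⋆ (f ∘ suc)) (suc (2 ℕ.* t))
    ≡⟨ cong₂ (λ s u → + 2 * (f 0 * f (suc s)) + u) (ℕ.*-suc 2 t) (sym eq) ⟨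
  + 2 * (f 0 * f (suc (2 ℕ.* suc t))) + + 2 * k
    ≡⟨ ℤ.*-distribˡ-+ (+ 2) (f 0 * f (suc (2 ℕ.* suc t))) k ⟨
  + 2 * (f 0 * f (suc (2 ℕ.* suc t)) + k)
    ∎)
  where open ≡-Reasoning

-- Thue–Morse signs

thueMorsePoly : ℕ → Series
thueMorsePoly zero    = 𝟙
thueMorsePoly (suc N) = thueMorsePoly N ⋆ (1-x^ (2 ℕ.^ N))

partialProd-neg : ∀ k N → partialProd -[1+ k ] N ≐ thueMorsePoly N ^ suc k
partialProd-neg k zero    s = trans (one≐𝟙 s) (sym (𝟙-^ (suc k) s))
partialProd-neg k (suc N) s = begin
  (partialProd -[1+ k ] N ⋆ factor (2 ℕ.^ N) -[1+ k ]) s                 ≡⟨ ⋆-cong (partialProd-neg k N) (factor-neg (2 ℕ.^ N) {{ℕ.m^n≢0 2 N}} k) s ⟩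
  ((thueMorsePoly N ^ suc k) ⋆ ((1-x^ (2 ℕ.^ N)) ^ suc k)) s             ≡⟨ ^-distrib-* (thueMorsePoly N) (1-x^ (2 ℕ.^ N)) (suc k) s ⟨
  ((thueMorsePoly N ⋆ (1-x^ (2 ℕ.^ N))) ^ suc k) s                       ∎
  where open ≡-Reasoning

thueMorsePoly-suc-< : ∀ N {s} → s ℕ.< 2 ℕ.^ N → thueMorsePoly (suc N) s ≡ thueMorsePoly N s
thueMorsePoly-suc-< N {s} s<2^N =
  trans (⋆-comm (thueMorsePoly N) (1-x^ (2 ℕ.^ N)) s) (1-x^-⋆-< (2 ℕ.^ N) (thueMorsePoly N) s<2^N)

thueMorsePoly-suc-+ : ∀ N r → thueMorsePoly (suc N) (2 ℕ.^ N ℕ.+ r) ≡ thueMorsePoly N (2 ℕ.^ N ℕ.+ r) - thueMorsePoly N r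
thueMorsePoly-suc-+ N r =
  trans (⋆-comm (thueMorsePoly N) (1-x^ (2 ℕ.^ N)) _) (1-x^-⋆-+ (2 ℕ.^ N) r (thueMorsePoly N))

thueMorsePoly-double : ∀ N b t → b ℕ.< 2 → thueMorsePoly (suc N) (b ℕ.+ 2 ℕ.* t) ≡ signPow b * thueMorsePoly N t
thueMorsePoly-double zero zero zero    _ = thueMorsePoly-suc-< 0 (s≤s z≤n)
thueMorsePoly-double zero zero (suc t) _ =
  trans (cong (thueMorsePoly 1) (ℕ.*-suc 2 t)) (thueMorsePoly-suc-+ 0 (suc (2 ℕ.* t)))
thueMorsePoly-double zero 1    zero    _ = thueMorsePoly-suc-+ 0 0
thueMorsePoly-double zero 1    (suc t) _ =
  trans (cong (λ s → thueMorsePoly 1 (suc s)) (ℕ.*-suc 2 t)) (thueMorsePoly-suc-+ 0 (suc (suc (2 ℕ.* t))))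
thueMorsePoly-double zero (suc (suc _)) _ (s≤s (s≤s ()))
thueMorsePoly-double (suc N) b t b<2 with split (2 ℕ.^ N) t
... | below t<2^N = begin
  P (suc (suc N)) (b ℕ.+ 2 ℕ.* t)      ≡⟨ thueMorsePoly-suc-< (suc N) (bit+double-< b<2 t<2^N) ⟩
  P (suc N) (b ℕ.+ 2 ℕ.* t)      ≡⟨ thueMorsePoly-double N b t b<2 ⟩
  σ * P N t                      ≡⟨ cong (σ *_) (thueMorsePoly-suc-< N t<2^N) ⟨
  σ * P (suc N) t                ∎
  where
  open ≡-Reasoning
  P = thueMorsePoly
  σ = signPow b
... | above r = begin
  P (suc (suc N)) (b ℕ.+ 2 ℕ.* (a ℕ.+ r))                  ≡⟨ cong (P (suc (suc N))) (bit+double-+ b a r) ⟩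
  P (suc (suc N)) (2 ℕ.* a ℕ.+ (b ℕ.+ 2 ℕ.* r))            ≡⟨ thueMorsePoly-suc-+ (suc N) (b ℕ.+ 2 ℕ.* r) ⟩
  P (suc N) (2 ℕ.* a ℕ.+ (b ℕ.+ 2 ℕ.* r)) - P (suc N) (b ℕ.+ 2 ℕ.* r)
    ≡⟨ cong (λ s → P (suc N) s - P (suc N) (b ℕ.+ 2 ℕ.* r)) (bit+double-+ b a r) ⟨
  P (suc N) (b ℕ.+ 2 ℕ.* (a ℕ.+ r)) - P (suc N) (b ℕ.+ 2 ℕ.* r)
    ≡⟨ cong₂ _-_ (thueMorsePoly-double N b (a ℕ.+ r) b<2) (thueMorsePoly-double N b r b<2) ⟩
  σ * P N (a ℕ.+ r) - σ * P N r                      ≡⟨ +-*-Solver.solve 3 (λ s u v → s :* (u :- v) := s :* u :- s :* v) refl σ (P N (a ℕ.+ r)) (P N r) ⟨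
  σ * (P N (a ℕ.+ r) - P N r)                        ≡⟨ cong (σ *_) (thueMorsePoly-suc-+ N r) ⟨
  σ * P (suc N) (a ℕ.+ r)                            ∎
  where
  open ≡-Reasoning
  P = thueMorsePoly
  open +-*-Solver using (_:*_; _:-_; _:=_)
  σ = signPow b
  a = 2 ℕ.^ N

thueMorsePoly-even : ∀ N t → thueMorsePoly (suc N) (2 ℕ.* t) ≡ thueMorsePoly N t
thueMorsePoly-even N t = trans (thueMorsePoly-double N 0 t (s≤s z≤n)) (ℤ.*-identityˡ _)

thueMorsePoly-odd : ∀ N t → thueMorsePoly (suc N) (suc (2 ℕ.* t)) ≡ - thueMorsePoly N t
thueMorsePoly-odd N t = trans (thueMorsePoly-double N 1 t (s≤s (s≤s z≤n))) (ℤ.-1*i≡-i _)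

thueMorsePoly-unit : ∀ N {s} → s ℕ.< 2 ℕ.^ N → IsUnit (thueMorsePoly N s)
thueMorsePoly-unit zero    {zero}  _          = inj₁ refl
thueMorsePoly-unit zero    {suc _} (s≤s ())
thueMorsePoly-unit (suc N) {s} s<2^N+1 with parity s
... | even t = subst IsUnit (sym (thueMorsePoly-even N t)) (thueMorsePoly-unit N (bit+double-<⁻¹ {0} s<2^N+1))
... | odd  t = subst IsUnit (sym (thueMorsePoly-odd N t)) (IsUnit-neg (thueMorsePoly-unit N (bit+double-<⁻¹ {1} s<2^N+1)))

thueMorsePoly-stable : ∀ N m {s} → s ℕ.< 2 ℕ.^ N → thueMorsePoly (N ℕ.+ m) s ≡ thueMorsePoly N s
thueMorsePoly-stable N zero    s<2^N = cong (λ M → thueMorsePoly M _) (ℕ.+-identityʳ N)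
thueMorsePoly-stable N (suc m) {s} s<2^N = begin
  thueMorsePoly (N ℕ.+ suc m) s    ≡⟨ cong (λ M → thueMorsePoly M s) (ℕ.+-suc N m) ⟩
  thueMorsePoly (suc (N ℕ.+ m)) s  ≡⟨ thueMorsePoly-suc-< (N ℕ.+ m) (ℕ.<-≤-trans s<2^N (ℕ.^-monoʳ-≤ 2 (ℕ.m≤m+n N m))) ⟩
  thueMorsePoly (N ℕ.+ m) s        ≡⟨ thueMorsePoly-stable N m s<2^N ⟩
  thueMorsePoly N s                ∎
  where open ≡-Reasoning

-- The factors 1 - x^(2^i) with 2^i > s do not affect the coefficient of x^s.
thueMorse : Series
thueMorse s = thueMorsePoly (suc s) s

thueMorsePoly≡thueMorse : ∀ N {s} → s ℕ.< 2 ℕ.^ N → thueMorsePoly N s ≡ thueMorse s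
thueMorsePoly≡thueMorse N {s} s<2^N with ℕ.≤-total N (suc s)
... | inj₁ N≤s+1 with ℕ.m≤n⇒∃[o]m+o≡n N≤s+1
...   | m , N+m≡s+1 = sym (trans (cong (λ M → thueMorsePoly M s) (sym N+m≡s+1)) (thueMorsePoly-stable N m s<2^N))
thueMorsePoly≡thueMorse N {s} s<2^N | inj₂ s+1≤N with ℕ.m≤n⇒∃[o]m+o≡n s+1≤N
...   | m , refl = thueMorsePoly-stable (suc s) m (n<2^[1+n] s)

thueMorse-unit : ∀ s → IsUnit (thueMorse s)
thueMorse-unit s = thueMorsePoly-unit (suc s) (n<2^[1+n] s)

thueMorse-double : ∀ b t → b ℕ.< 2 → thueMorse (b ℕ.+ 2 ℕ.* t) ≡ signPow b * thueMorse t
thueMorse-double b t b<2 = begin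
  thueMorse (b ℕ.+ 2 ℕ.* t)                        ≡⟨ thueMorsePoly≡thueMorse (suc (suc t)) (bit+double-< b<2 (n<2^[1+n] t)) ⟨
  thueMorsePoly (suc (suc t)) (b ℕ.+ 2 ℕ.* t)      ≡⟨ thueMorsePoly-double (suc t) b t b<2 ⟩
  signPow b * thueMorse t                          ∎
  where open ≡-Reasoning

thueMorse-even : ∀ t → thueMorse (2 ℕ.* t) ≡ thueMorse t
thueMorse-even t = trans (thueMorse-double 0 t (s≤s z≤n)) (ℤ.*-identityˡ _)

thueMorse-odd : ∀ t → thueMorse (suc (2 ℕ.* t)) ≡ - thueMorse t
thueMorse-odd t = trans (thueMorse-double 1 t (s≤s (s≤s z≤n))) (ℤ.-1*i≡-i _)

jumps : Series
jumps zero    = + 0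
jumps (suc s) = jump (thueMorse s) (thueMorse (suc s))

jumps-cases : ∀ s → jumps (suc s) ≡ + 0 ⊎ IsUnit (jumps (suc s))
jumps-cases s = jump-units-cases (thueMorse-unit s) (thueMorse-unit (suc s))

1-x-⋆-thueMorse : (1-x^ 1) ⋆ thueMorse ≐ 𝟙 ⊕ const (+ 2) ⋆ jumps
1-x-⋆-thueMorse zero    = refl
1-x-⋆-thueMorse (suc s) = begin
  ((1-x^ 1) ⋆ thueMorse) (suc s)           ≡⟨ 1-x^-⋆-+ 1 s thueMorse ⟩
  thueMorse (suc s) - thueMorse s          ≡⟨ jump-units (thueMorse-unit s) (thueMorse-unit (suc s)) ⟩
  + 2 * jumps (suc s)                      ≡⟨ ℤ.+-identityˡ _ ⟨
  + 0 + + 2 * jumps (suc s)                ≡⟨ cong (_+_ (+ 0)) (const-⋆ (+ 2) jumps (suc s)) ⟨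
  (𝟙 ⊕ const (+ 2) ⋆ jumps) (suc s)        ∎
  where open ≡-Reasoning

jumps+jumps² : Series
jumps+jumps² = jumps ⊕ jumps ⋆ jumps

jumps+jumps²-Odd : ∀ s → Odd (jumps+jumps² (suc s))
jumps+jumps²-Odd s = go (parity (suc s)) (λ ())
  where
  go : ∀ {n} → Parity n → n ≢ 0 → Odd (jumps+jumps² n)
  go (even zero) 0≢0 = contradiction refl 0≢0
  go (even (suc t)) _ = even-case (⋆-self-even jumps (suc t))
    where
    open ≡-Reasoning
    a = jump (- thueMorse t) (thueMorse (suc t))
    j = jumps (suc t)
    jumps-2t+2 : jumps (2 ℕ.* suc t) ≡ a
    jumps-2t+2 = begin
      jumps (2 ℕ.* suc t)                                                   ≡⟨ cong jumps (ℕ.*-suc 2 t) ⟩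
      jump (thueMorse (suc (2 ℕ.* t))) (thueMorse (suc (suc (2 ℕ.* t))))    ≡⟨ cong₂ jump (thueMorse-odd t) (trans (cong thueMorse (sym (ℕ.*-suc 2 t))) (thueMorse-even (suc t))) ⟩
      a                                                                     ∎
    even-case : ∃[ k ] (jumps ⋆ jumps) (2 ℕ.* suc t) ≡ j * j + + 2 * k → Odd (jumps+jumps² (2 ℕ.* suc t))
    even-case (k , eq) = subst Odd (sym (begin
      jumps (2 ℕ.* suc t) + (jumps ⋆ jumps) (2 ℕ.* suc t)  ≡⟨ cong₂ _+_ jumps-2t+2 eq ⟩
      a + (j * j + + 2 * k)                               ≡⟨ ℤ.+-assoc a (j * j) (+ 2 * k) ⟨
      a + j * j + + 2 * k                                 ∎))
      (Odd-+-even k (jump-neg+jump²-Odd (thueMorse-unit t) (thueMorse-unit (suc t))))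
  go (odd t) _ = odd-case (⋆-self-odd jumps t)
    where
    odd-case : ∃[ k ] (jumps ⋆ jumps) (suc (2 ℕ.* t)) ≡ + 2 * k → Odd (jumps+jumps² (suc (2 ℕ.* t)))
    odd-case (k , eq) = subst Odd (sym (cong₂ _+_ (cong₂ jump (thueMorse-even t) (thueMorse-odd t)) eq))
                              (Odd-+-even k (jump-neg-Odd (thueMorse-unit t)))

-- Squaring gains a power of 2

-- F ≡ 1 + 2^e V (mod 2^(e+1)), coefficientwise
infix 4 _≈1+2^[_]⋆_
_≈1+2^[_]⋆_ : Series → ℕ → Series → Set
F ≈1+2^[ e ]⋆ V = ∃[ E ] F ≐ 𝟙 ⊕ const ((+ 2) ℤ.^ e) ⋆ (V ⊕ const (+ 2) ⋆ E)

≈1+2^-resp : ∀ {F F′ e V} → F ≐ F′ → F ≈1+2^[ e ]⋆ V → F′ ≈1+2^[ e ]⋆ V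
≈1+2^-resp F≐F′ (E , F≐) = E , λ n → trans (sym (F≐F′ n)) (F≐ n)

𝟙⊕-⋆-congˡ : ∀ {X Y} B → X ≐ Y → 𝟙 ⊕ X ⋆ B ≐ 𝟙 ⊕ Y ⋆ B
𝟙⊕-⋆-congˡ B X≐Y n = cong (_+_ (𝟙 n)) (⋆-cong {g = B} X≐Y (λ _ → refl) n)

const-2^-suc : ∀ e → const ((+ 2) ℤ.^ suc e) ≐ const (+ 2) ⋆ const ((+ 2) ℤ.^ e)
const-2^-suc e = const-* (+ 2) ((+ 2) ℤ.^ e)

const-2^[2+e] : ∀ e → const ((+ 2) ℤ.^ (2 ℕ.+ e)) ≐ const (+ 2) ⋆ (const (+ 2) ⋆ const ((+ 2) ℤ.^ e))
const-2^[2+e] e n = trans (const-2^-suc (suc e) n) (⋆-cong {const (+ 2)} (λ _ → refl) (const-2^-suc e) n)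

1+4V-^-odd : ∀ V o → (𝟙 ⊕ const (+ 4) ⋆ V) ^ suc (2 ℕ.* o) ≈1+2^[ 2 ]⋆ V
1+4V-^-odd V zero    = const (+ 0) ,
  solve 1 (λ V → (con (+ 1) :+ con (+ 4) :* V) :^ 1 := con (+ 1) :+ con (+ 4) :* (V :+ con (+ 2) :* con (+ 0))) (λ _ → refl) V
  where open ⋆-Solver
1+4V-^-odd V (suc o) with 1+4V-^-odd V o
... | E , W^2o+1≐ = E′ , λ n → begin
  (W ^ suc (2 ℕ.* suc o)) n                 ≡⟨ cong (λ m → (W ^ suc m) n) (ℕ.*-suc 2 o) ⟩
  (W ⋆ (W ⋆ (W ^ suc (2 ℕ.* o)))) n         ≡⟨ ⋆-cong {W} (λ _ → refl) (⋆-cong {W} (λ _ → refl) W^2o+1≐) n ⟩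
  (W ⋆ (W ⋆ (𝟙 ⊕ const (+ 4) ⋆ A))) n
    ≡⟨ solve 2 (λ V E →
         (con (+ 1) :+ con (+ 4) :* V) :* ((con (+ 1) :+ con (+ 4) :* V) :* (con (+ 1) :+ con (+ 4) :* (V :+ con (+ 2) :* E)))
         := con (+ 1) :+ con (+ 4) :* (V :+ con (+ 2) :* (E :+ (V :+ con (+ 2) :* (V :* V))
                                      :+ con (+ 4) :* ((V :+ con (+ 2) :* E) :* (V :+ con (+ 2) :* (V :* V))))))
       (λ _ → refl) V E n ⟩
  (𝟙 ⊕ const (+ 4) ⋆ (V ⊕ const (+ 2) ⋆ E′)) n ∎
  where
  open ≡-Reasoning
  open ⋆-Solver
  W = 𝟙 ⊕ const (+ 4) ⋆ V
  A = V ⊕ const (+ 2) ⋆ E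
  E′ = E ⊕ (V ⊕ const (+ 2) ⋆ (V ⋆ V)) ⊕ const (+ 4) ⋆ (A ⋆ (V ⊕ const (+ 2) ⋆ (V ⋆ V)))

≈1+2^-square : ∀ {F e V} → F ≈1+2^[ 2 ℕ.+ e ]⋆ V → F ⋆ F ≈1+2^[ 3 ℕ.+ e ]⋆ V
≈1+2^-square {F} {e} {V} (E , F≐) = E′ , λ n → begin
  (F ⋆ F) n                                          ≡⟨ ⋆-cong F≐′ F≐′ n ⟩
  ((𝟙 ⊕ (c2 ⋆ (c2 ⋆ M)) ⋆ A) ⋆ (𝟙 ⊕ (c2 ⋆ (c2 ⋆ M)) ⋆ A)) n
    ≡⟨ solve 3 (λ M V E →
         (con (+ 1) :+ (con (+ 2) :* (con (+ 2) :* M)) :* (V :+ con (+ 2) :* E))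
           :* (con (+ 1) :+ (con (+ 2) :* (con (+ 2) :* M)) :* (V :+ con (+ 2) :* E))
         := con (+ 1) :+ (con (+ 2) :* (con (+ 2) :* (con (+ 2) :* M))) :* (V :+ con (+ 2) :* (E :+ M :* ((V :+ con (+ 2) :* E) :* (V :+ con (+ 2) :* E)))))
       (λ _ → refl) M V E n ⟩
  (𝟙 ⊕ (c2 ⋆ (c2 ⋆ (c2 ⋆ M))) ⋆ (V ⊕ c2 ⋆ E′)) n      ≡⟨ 𝟙⊕-⋆-congˡ (V ⊕ c2 ⋆ E′) 2^[3+e] n ⟨
  (𝟙 ⊕ const ((+ 2) ℤ.^ (3 ℕ.+ e)) ⋆ (V ⊕ c2 ⋆ E′)) n ∎
  where
  open ≡-Reasoning
  open ⋆-Solver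
  c2 = const (+ 2)
  M = const ((+ 2) ℤ.^ e)
  A = V ⊕ c2 ⋆ E
  E′ = E ⊕ M ⋆ (A ⋆ A)
  2^[3+e] : const ((+ 2) ℤ.^ (3 ℕ.+ e)) ≐ c2 ⋆ (c2 ⋆ (c2 ⋆ M))
  2^[3+e] n = trans (const-2^-suc (2 ℕ.+ e) n) (⋆-cong {c2} (λ _ → refl) (const-2^[2+e] e) n)
  F≐′ : F ≐ 𝟙 ⊕ (c2 ⋆ (c2 ⋆ M)) ⋆ A
  F≐′ n = trans (F≐ n) (𝟙⊕-⋆-congˡ A (const-2^[2+e] e) n)

1+4V-^ : ∀ V j → j ≢ 0 → ∃[ e ] (𝟙 ⊕ const (+ 4) ⋆ V) ^ j ≈1+2^[ 2 ℕ.+ e ]⋆ V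
1+4V-^ V = <-rec _ step
  where
  W = 𝟙 ⊕ const (+ 4) ⋆ V
  step : ∀ j → (∀ {i} → i ℕ.< j → i ≢ 0 → ∃[ e ] W ^ i ≈1+2^[ 2 ℕ.+ e ]⋆ V) →
         j ≢ 0 → ∃[ e ] W ^ j ≈1+2^[ 2 ℕ.+ e ]⋆ V
  step j rec j≢0 with parity j
  ... | odd t          = 0 , 1+4V-^-odd V t
  ... | even zero      = contradiction refl j≢0
  ... | even (suc t) with rec (ℕ.m<m+n (suc t) (s≤s z≤n)) (λ ())
  ...   | e , W^t≈ = suc e , ≈1+2^-resp {e = 3 ℕ.+ e} {V = V} W^t⋆W^t≐W^2t (≈1+2^-square {W ^ suc t} {e} {V} W^t≈)
    where
    W^t⋆W^t≐W^2t : (W ^ suc t) ⋆ (W ^ suc t) ≐ W ^ (2 ℕ.* suc t)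
    W^t⋆W^t≐W^2t n = sym (trans (^-homo-* W (suc t) (suc t ℕ.+ 0) n)
                                (⋆-cong {W ^ suc t} (λ _ → refl) (^-congʳ W (ℕ.+-identityʳ (suc t))) n))

⊕2⋆-coeff : ∀ V E n → (V ⊕ const (+ 2) ⋆ E) n ≡ V n + + 2 * E n
⊕2⋆-coeff V E n = cong (_+_ (V n)) (const-⋆ (+ 2) E n)

𝟙⊕2⋆-≢0 : ∀ X → (∀ s → X (suc s) ≢ + 0) → ∀ n → (𝟙 ⊕ const (+ 2) ⋆ X) n ≢ + 0
𝟙⊕2⋆-≢0 X X≢0 zero    = Odd⇒≢0 (X 0 , ⊕2⋆-coeff 𝟙 X 0)
𝟙⊕2⋆-≢0 X X≢0 (suc s) = *-≢0 {+ 2} (λ ()) (X≢0 s) ∘ trans (sym (trans (⊕2⋆-coeff 𝟙 X (suc s)) (ℤ.+-identityˡ _)))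

≈1+2^-≢0 : ∀ {F e V} → F ≈1+2^[ 2 ℕ.+ e ]⋆ V → (∀ s → Odd (V (suc s))) → ∀ n → F n ≢ + 0
≈1+2^-≢0 {F} {e} {V} (E , F≐) V-odd n = 𝟙⊕2⋆-≢0 X X≢0 n ∘ trans (sym (F≐′ n))
  where
  open ⋆-Solver
  c2 = const (+ 2)
  M = const ((+ 2) ℤ.^ e)
  A = V ⊕ c2 ⋆ E
  X = c2 ⋆ (M ⋆ A)
  F≐′ : F ≐ 𝟙 ⊕ c2 ⋆ X
  F≐′ n = trans (F≐ n) (trans (𝟙⊕-⋆-congˡ A (const-2^[2+e] e) n)
    (cong (_+_ (𝟙 n)) (solve 2 (λ M A → (con (+ 2) :* (con (+ 2) :* M)) :* A := con (+ 2) :* (con (+ 2) :* (M :* A))) (λ _ → refl) M A n)))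
  X≢0 : ∀ s → X (suc s) ≢ + 0
  X≢0 s = *-≢0 {+ 2} (λ ()) (*-≢0 (2^≢0 e) (Odd⇒≢0 (Odd-+-even (E (suc s)) (V-odd s)))) ∘ trans (sym X-coeff)
    where
    X-coeff : X (suc s) ≡ + 2 * ((+ 2) ℤ.^ e * (V (suc s) + + 2 * E (suc s)))
    X-coeff = trans (const-⋆ (+ 2) (M ⋆ A) (suc s)) (cong (_*_ (+ 2)) (trans (const-⋆ ((+ 2) ℤ.^ e) A (suc s)) (cong (_*_ ((+ 2) ℤ.^ e)) (⊕2⋆-coeff V E (suc s)))))

1+2D⋆-≢0 : ∀ {F e V} D → F ≈1+2^[ 2 ℕ.+ e ]⋆ V → (∀ s → Odd (V (suc s))) →
           (∀ s → D (suc s) ≡ + 0 ⊎ IsUnit (D (suc s))) → ∀ n → ((𝟙 ⊕ const (+ 2) ⋆ D) ⋆ F) n ≢ + 0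
1+2D⋆-≢0 {F} {e} {V} D (E , F≐) V-odd D-cases n = 𝟙⊕2⋆-≢0 X X≢0 n ∘ trans (sym (GF≐ n))
  where
  open ⋆-Solver
  c2 = const (+ 2)
  M = const ((+ 2) ℤ.^ e)
  A = V ⊕ c2 ⋆ E
  B = A ⊕ c2 ⋆ (D ⋆ A)
  X = D ⊕ c2 ⋆ (M ⋆ B)
  GF≐ : (𝟙 ⊕ c2 ⋆ D) ⋆ F ≐ 𝟙 ⊕ c2 ⋆ X
  GF≐ n = begin
    ((𝟙 ⊕ c2 ⋆ D) ⋆ F) n                                 ≡⟨ ⋆-cong {𝟙 ⊕ c2 ⋆ D} (λ _ → refl) (λ n → trans (F≐ n) (𝟙⊕-⋆-congˡ A (const-2^[2+e] e) n)) n ⟩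
    ((𝟙 ⊕ c2 ⋆ D) ⋆ (𝟙 ⊕ (c2 ⋆ (c2 ⋆ M)) ⋆ A)) n
      ≡⟨ solve 3 (λ D M A →
           (con (+ 1) :+ con (+ 2) :* D) :* (con (+ 1) :+ (con (+ 2) :* (con (+ 2) :* M)) :* A)
           := con (+ 1) :+ con (+ 2) :* (D :+ con (+ 2) :* (M :* (A :+ con (+ 2) :* (D :* A)))))
         (λ _ → refl) D M A n ⟩
    (𝟙 ⊕ c2 ⋆ X) n                                       ∎
    where open ≡-Reasoning
  B-odd : ∀ s → Odd (B (suc s))
  B-odd s = subst Odd (sym (trans (⊕2⋆-coeff A (D ⋆ A) (suc s)) (cong (λ y → y + + 2 * (D ⋆ A) (suc s)) (⊕2⋆-coeff V E (suc s)))))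
                  (Odd-+-even ((D ⋆ A) (suc s)) (Odd-+-even (E (suc s)) (V-odd s)))
  X-coeff : ∀ s → X (suc s) ≡ D (suc s) + + 2 * ((+ 2) ℤ.^ e * B (suc s))
  X-coeff s = trans (⊕2⋆-coeff D (M ⋆ B) (suc s)) (cong (λ y → D (suc s) + + 2 * y) (const-⋆ ((+ 2) ℤ.^ e) B (suc s)))
  X≢0 : ∀ s → X (suc s) ≢ + 0
  X≢0 s with D-cases s
  ... | inj₁ D≡0 = *-≢0 {+ 2} (λ ()) (*-≢0 (2^≢0 e) (Odd⇒≢0 (B-odd s))) ∘ trans (sym (trans (X-coeff s) (trans (cong (λ y → y + + 2 * ((+ 2) ℤ.^ e * B (suc s))) D≡0) (ℤ.+-identityˡ _))))
  ... | inj₂ D-unit = Odd⇒≢0 (Odd-+-even ((+ 2) ℤ.^ e * B (suc s)) (IsUnit⇒Odd D-unit)) ∘ trans (sym (X-coeff s))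

infix 4 _≐[≤_]_
_≐[≤_]_ : Series → ℕ → Series → Set
f ≐[≤ n ] g = ∀ s → s ℕ.≤ n → f s ≡ g s

⋆-cong-≤ : ∀ {n f f′ g g′} → f ≐[≤ n ] f′ → g ≐[≤ n ] g′ → f ⋆ g ≐[≤ n ] f′ ⋆ g′
⋆-cong-≤ {n} {f} {f′} {g} {g′} f≐f′ g≐g′ s s≤n = begin
  (f ⋆ g) s                        ≡⟨ ⋆-coeff f g s ⟩
  ∑[ i ≤ s ] (f i * g (s ∸ i))     ≡⟨ sum≤-cong s (λ i i≤s → cong₂ _*_ (f≐f′ i (ℕ.≤-trans i≤s s≤n)) (g≐g′ (s ∸ i) (ℕ.≤-trans (ℕ.m∸n≤m s i) s≤n))) ⟩
  ∑[ i ≤ s ] (f′ i * g′ (s ∸ i))   ≡⟨ ⋆-coeff f′ g′ s ⟨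
  (f′ ⋆ g′) s                      ∎
  where open ≡-Reasoning

^-cong-≤ : ∀ {n f g} k → f ≐[≤ n ] g → f ^ k ≐[≤ n ] g ^ k
^-cong-≤ zero    f≐g s _ = refl
^-cong-≤ (suc k) f≐g     = ⋆-cong-≤ f≐g (^-cong-≤ k f≐g)

thueMorsePoly≐[≤]thueMorse : ∀ n → thueMorsePoly (suc n) ≐[≤ n ] thueMorse
thueMorsePoly≐[≤]thueMorse n s s≤n = thueMorsePoly≡thueMorse (suc n) (ℕ.≤-<-trans s≤n (n<2^[1+n] n))

1+2jumps : Series
1+2jumps = 𝟙 ⊕ const (+ 2) ⋆ jumps

c-neg≡1+2jumps-^ : ∀ k n → c -[1+ k ] n ≡ (1+2jumps ^ suc k) n
c-neg≡1+2jumps-^ k n = begin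
  (invOneMinusPow -[1+ k ] ⋆ partialProd -[1+ k ] (suc n)) n
    ≡⟨ ⋆-cong (λ j → sym (1-x-^-coeff (suc k) j)) (partialProd-neg k (suc n)) n ⟩
  (((1-x^ 1) ^ suc k) ⋆ (thueMorsePoly (suc n) ^ suc k)) n
    ≡⟨ ^-distrib-* (1-x^ 1) (thueMorsePoly (suc n)) (suc k) n ⟨
  (((1-x^ 1) ⋆ thueMorsePoly (suc n)) ^ suc k) n
    ≡⟨ ^-cong-≤ (suc k) (⋆-cong-≤ {f = 1-x^ 1} (λ _ _ → refl) (thueMorsePoly≐[≤]thueMorse n)) n ℕ.≤-refl ⟩
  (((1-x^ 1) ⋆ thueMorse) ^ suc k) n
    ≡⟨ ^-congˡ (suc k) 1-x-⋆-thueMorse n ⟩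
  (1+2jumps ^ suc k) n ∎
  where open ≡-Reasoning

1+2jumps-square : 1+2jumps ^ 2 ≐ 𝟙 ⊕ const (+ 4) ⋆ jumps+jumps²
1+2jumps-square = solve 1 (λ D → (con (+ 1) :+ con (+ 2) :* D) :^ 2 := con (+ 1) :+ con (+ 4) :* (D :+ D :* D)) (λ _ → refl) jumps
  where open ⋆-Solver

1+2jumps-^-even : ∀ t → t ≢ 0 → ∃[ e ] 1+2jumps ^ (2 ℕ.* t) ≈1+2^[ 2 ℕ.+ e ]⋆ jumps+jumps²
1+2jumps-^-even t t≢0 =
  let e , W^t≈ = 1+4V-^ jumps+jumps² t t≢0 in e , ≈1+2^-resp {e = 2 ℕ.+ e} {V = jumps+jumps²} W^t≐1+2jumps^2t W^t≈
  where
  W^t≐1+2jumps^2t : (𝟙 ⊕ const (+ 4) ⋆ jumps+jumps²) ^ t ≐ 1+2jumps ^ (2 ℕ.* t)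
  W^t≐1+2jumps^2t n = trans (sym (^-congˡ t 1+2jumps-square n)) (^-assocʳ 1+2jumps 2 t n)

1+2jumps-^-≢0 : ∀ j → 2 ℕ.≤ j → ∀ n → (1+2jumps ^ j) n ≢ + 0
1+2jumps-^-≢0 j 2≤j n = go (parity j) 2≤j
  where
  go : ∀ {j} → Parity j → 2 ℕ.≤ j → (1+2jumps ^ j) n ≢ + 0
  go (even zero)    ()
  go (odd zero)     (s≤s ())
  go (even (suc t)) _ = let e , lifted = 1+2jumps-^-even (suc t) (λ ()) in
    ≈1+2^-≢0 {1+2jumps ^ (2 ℕ.* suc t)} {e} {jumps+jumps²} lifted jumps+jumps²-Odd n
  go (odd (suc t))  _ = let e , lifted = 1+2jumps-^-even (suc t) (λ ()) in
    1+2D⋆-≢0 {1+2jumps ^ (2 ℕ.* suc t)} {e} {jumps+jumps²} jumps lifted jumps+jumps²-Odd jumps-cases n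

corollary2p9 : (m : ℤ) → m < -[1+ 0 ] → (n : ℕ) → c m n ≢ + 0
corollary2p9 (+ _)           ()           n
corollary2p9 -[1+ zero ]     (ℤ.-<- ())   n
corollary2p9 -[1+ suc k ]    _            n = 1+2jumps-^-≢0 (suc (suc k)) (s≤s (s≤s z≤n)) n ∘ trans (sym (c-neg≡1+2jumps-^ (suc k) n))
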